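{- Let $D>1$ be a square-free integer with $D\equiv1\pmod4$. Let $m_1,m_2$ be even positive integers and $\mu_1,\mu_2$ integers with $\mu_j^2\equiv D\pmod{m_j}$ and $\frac{D-\mu_j^2}{m_j}$ even for $j=1,2$. Let $n\ge1$ and $\nu$ an integer with $\nu^2\equiv D\pmod n$, and suppose $m_1\equiv m_2\equiv0\pmod n$ and $\mu_1\equiv\mu_2\equiv\nu\pmod n$. Suppose there exists $\gamma\in\operatorname{SL}(2,\mathbb{Z})$ with $$\begin{pmatrix}1&\frac{\mu_1-1}{2}\\0&\frac{m_1}{2}\end{pmatrix}\begin{pmatrix}\frac{1+\sqrt D}{2}&\frac{1-\sqrt D}{2}\\1&1\end{pmatrix}\begin{pmatrix}\zeta&0\\0&\overline\zeta\end{pmatrix}=\gamma\begin{pmatrix}1&\frac{\mu_2-1}{2}\\0&\frac{m_2}{2}\end{pmatrix}\begin{pmatrix}\frac{1+\sqrt D}{2}&\frac{1-\sqrt D}{2}\\1&1\end{pmatrix}$$ for some totally positive $\zeta\in\mathbb{Q}(\sqrt D)$. (i) If $n$ is odd, then $\gamma\in\Gamma_0(n)$. (ii) If $n$ is even, then $\gamma\in\Gamma_0(\frac n2)$.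
   Context: For $\zeta=a+b\sqrt D$, $\overline\zeta=a-b\sqrt D$ (with $\sqrt D>0$); $\zeta$ is totally positive if $\zeta>0$ and $\overline\zeta>0$. $\Gamma_0(N)=\{\begin{pmatrix}a&b\\c&d\end{pmatrix}\in\operatorname{SL}(2,\mathbb{Z}):c\equiv0\pmod N\}$. -}

module Defs where

open import Data.Nat as ℕ using (ℕ)
open import Data.Nat.Primality using (Prime)
open import Data.Integer as ℤ using (ℤ; +_)
open import Data.Integer.Divisibility as ℤD using ()
open import Data.Rational as ℚ using (ℚ; 0ℚ; 1ℚ)
open import Data.Product using (_×_)
open import Data.Sum using (_⊎_)
open import Relation.Binary.PropositionalEquality using (_≡_)
open import Relation.Nullary using (¬_)

SquareFree : ℤ → Set
SquareFree D = ∀ (p : ℕ) → Prime p → ¬ ((+ (p ℕ.* p)) ℤD.∣ D)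

record QD : Set where
  constructor _+√_
  field
    re : ℚ
    im : ℚ
open QD public

module _ (D : ℤ) where
  private d = D ℚ./ 1

  embQ : ℚ → QD
  embQ a = a +√ 0ℚ

  embZ : ℤ → QD
  embZ z = embQ (z ℚ./ 1)

  √D : QD
  √D = 0ℚ +√ 1ℚ

  addQD : QD → QD → QD
  addQD (a +√ b) (c +√ e) = (a ℚ.+ c) +√ (b ℚ.+ e)

  mulQD : QD → QD → QD
  mulQD (a +√ b) (c +√ e) = (a ℚ.* c ℚ.+ b ℚ.* e ℚ.* d) +√ (a ℚ.* e ℚ.+ b ℚ.* c)

  conj : QD → QD
  conj (a +√ b) = a +√ (ℚ.- b)

  -- a + b√D > 0 as a real number (√D the positive root, D > 1 not a square).
  -- Decided by comparing a² and b²D according to the signs of a and b.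
  Pos : QD → Set
  Pos (a +√ b) =
      (0ℚ ℚ.≤ a × 0ℚ ℚ.≤ b × ¬ (a ≡ 0ℚ × b ≡ 0ℚ))
    ⊎ (0ℚ ℚ.< a × b ℚ.< 0ℚ × b ℚ.* b ℚ.* d ℚ.< a ℚ.* a)
    ⊎ (a ℚ.< 0ℚ × 0ℚ ℚ.< b × a ℚ.* a ℚ.< b ℚ.* b ℚ.* d)

  TotallyPositive : QD → Set
  TotallyPositive ζ = Pos ζ × Pos (conj ζ)

record M2 (A : Set) : Set where
  constructor mat
  field
    m11 m12 m21 m22 : A
open M2 public

module _ (D : ℤ) where
  mulM : M2 QD → M2 QD → M2 QD
  mulM (mat a b c e) (mat a' b' c' e') =
    mat (addQD D (mulQD D a a') (mulQD D b c'))
        (addQD D (mulQD D a b') (mulQD D b e'))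
        (addQD D (mulQD D c a') (mulQD D e c'))
        (addQD D (mulQD D c b') (mulQD D e e'))

  embM : M2 ℤ → M2 QD
  embM (mat a b c e) = mat (embZ D a) (embZ D b) (embZ D c) (embZ D e)

  W : M2 QD
  W = mat ((+ 1 ℚ./ 2) +√ (+ 1 ℚ./ 2)) ((+ 1 ℚ./ 2) +√ (ℤ.- (+ 1) ℚ./ 2))
          (embQ D 1ℚ) (embQ D 1ℚ)

  Amat : ℕ → ℤ → M2 QD
  Amat m μ = mat (embQ D 1ℚ) (embQ D ((μ ℤ.- + 1) ℚ./ 2))
                 (embQ D 0ℚ) (embQ D (+ m ℚ./ 2))

  diagM : QD → M2 QD
  diagM ζ = mat ζ (embQ D 0ℚ) (embQ D 0ℚ) (conj D ζ)

InSL2Z : M2 ℤ → Set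
InSL2Z (mat a b c e) = a ℤ.* e ℤ.- b ℤ.* c ≡ + 1

InΓ₀ : ℕ → M2 ℤ → Set
InΓ₀ N γ = InSL2Z γ × (+ N) ℤD.∣ m21 γ

-- It says that
-- ζ (μ₁ + √D, m₁) = γ (μ₂ + √D, m₂); eliminating ζ and comparing rational and
-- √D-parts gives the integer identities
--   m₁ a = c (μ₁ + μ₂) + d m₂   and   c (D - μ₂²) = m₂ (d (μ₂ - μ₁) + m₁ b).
-- Modulo n the first gives n ∣ 2cν, and the second, divided by m₂, gives
-- n ∣ c q₂ where D - μ₂² = m₂ q₂.  A common divisor s of n, ν and q₂ also
-- divides μ₂ and m₂, so s² ∣ μ₂² + m₂ q₂ = D, and s = 1 as D is square-free.
-- Hence n ∣ 2c, which is the claim after removing the factor 2.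
module Submission where

open import Defs
open import Data.Nat as ℕ using (ℕ; _%_; _/_)
open import Data.Nat.Divisibility using (_∣_)
open import Data.Integer as ℤ using (ℤ; +_)
open import Data.Integer.Divisibility as ℤD using ()
open import Data.Product using (_×_; ∃-syntax)
open import Relation.Binary.PropositionalEquality using (_≡_)

open import Data.Nat using (zero; suc)
open import Data.Nat.Divisibility
  using (divides; ∣-trans; *-pres-∣; *-cancelˡ-∣; 0∣⇒≡0; _∣0; n∣m⇒m%n≡0; m%n≡0⇒n∣m)
import Data.Nat.Properties as ℕP
open import Data.Nat.DivMod using (m*[n/m]≡n)
open import Data.Nat.GCD using (gcd; gcd-greatest; gcd[m,n]∣m; gcd[m,n]∣n; c*gcd[m,n]≡gcd[cm,cn])
open import Data.Nat.Coprimality using (Coprime; coprime-divisor)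
open import Data.Nat.Primality using (prime[2]; prime⇒irreducible)
open import Data.Nat.Primality.Factorisation using (factorise)
open import Data.Nat.ListAction using (product)
import Data.Integer
import Data.Integer.Properties as ℤP
import Data.Integer.Divisibility.Signed as ℤS
import Data.Integer.Solver as ℤSolver
import Data.Rational
open import Data.Rational as ℚ using (ℚ; 0ℚ; 1ℚ; ½; toℚᵘ)
open import Data.Rational.Properties
  using (toℚᵘ-injective; toℚᵘ-fromℚᵘ; toℚᵘ-homo-+; toℚᵘ-homo-*; toℚᵘ-homo‿-)
open import Data.Rational.Unnormalised as ℚᵘ using (mkℚᵘ; *≡*) renaming (_≃_ to _≃ᵘ_)
import Data.Rational.Unnormalised.Properties as ℚᵘP
import Data.Rational.Solver as ℚSolver
open import Data.List using ([]; _∷_)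
open import Data.List.Relation.Unary.All using (_∷_)
open import Data.Vec using (Vec; []; _∷_)
open import Data.Fin using (#_)
open import Data.Product using (_,_)
open import Data.Sum using (inj₁; inj₂)
open import Data.Empty using (⊥-elim)
open import Function using (_∘_)
open import Relation.Binary.PropositionalEquality
  using (refl; sym; trans; cong; cong₂; subst; subst₂; module ≡-Reasoning)

fromℤ : ℤ → ℚ
fromℤ i = i ℚ./ 1

private
  toℚᵘ-/ : ∀ i n → toℚᵘ (i ℚ./ suc n) ≃ᵘ mkℚᵘ i n
  toℚᵘ-/ i n = toℚᵘ-fromℚᵘ (mkℚᵘ i n)

fromℤ-injective : ∀ {i j} → fromℤ i ≡ fromℤ j → i ≡ j
fromℤ-injective {i} {j} eq
  with *≡* i*1≡j*1 ← ℚᵘP.≃-trans (ℚᵘP.≃-sym (toℚᵘ-/ i 0))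
                       (ℚᵘP.≃-trans (ℚᵘP.≃-reflexive (cong toℚᵘ eq)) (toℚᵘ-/ j 0))
  = trans (sym (ℤP.*-identityʳ i)) (trans i*1≡j*1 (ℤP.*-identityʳ j))

module _ where
  open ℚᵘP.≃-Reasoning
  open ℤSolver.+-*-Solver

  fromℤ-homo-+ : ∀ i j → fromℤ (i ℤ.+ j) ≡ fromℤ i ℚ.+ fromℤ j
  fromℤ-homo-+ i j = toℚᵘ-injective (begin
    toℚᵘ (fromℤ (i ℤ.+ j))             ≈⟨ toℚᵘ-/ (i ℤ.+ j) 0 ⟩
    mkℚᵘ (i ℤ.+ j) 0                   ≈⟨ *≡* (solve 2 (λ i j → (i :+ j) :* con (+ 1)
                                             := (i :* con (+ 1) :+ j :* con (+ 1)) :* con (+ 1)) refl i j) ⟩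
    mkℚᵘ i 0 ℚᵘ.+ mkℚᵘ j 0            ≈⟨ ℚᵘP.+-cong (toℚᵘ-/ i 0) (toℚᵘ-/ j 0) ⟨
    toℚᵘ (fromℤ i) ℚᵘ.+ toℚᵘ (fromℤ j) ≈⟨ toℚᵘ-homo-+ (fromℤ i) (fromℤ j) ⟨
    toℚᵘ (fromℤ i ℚ.+ fromℤ j)         ∎)

  fromℤ-homo-* : ∀ i j → fromℤ (i ℤ.* j) ≡ fromℤ i ℚ.* fromℤ j
  fromℤ-homo-* i j = toℚᵘ-injective (begin
    toℚᵘ (fromℤ (i ℤ.* j))             ≈⟨ toℚᵘ-/ (i ℤ.* j) 0 ⟩
    mkℚᵘ (i ℤ.* j) 0                   ≈⟨ *≡* (solve 2 (λ i j → (i :* j) :* con (+ 1)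
                                             := (i :* j) :* con (+ 1)) refl i j) ⟩
    mkℚᵘ i 0 ℚᵘ.* mkℚᵘ j 0            ≈⟨ ℚᵘP.*-cong (toℚᵘ-/ i 0) (toℚᵘ-/ j 0) ⟨
    toℚᵘ (fromℤ i) ℚᵘ.* toℚᵘ (fromℤ j) ≈⟨ toℚᵘ-homo-* (fromℤ i) (fromℤ j) ⟨
    toℚᵘ (fromℤ i ℚ.* fromℤ j)         ∎)

  fromℤ-homo‿- : ∀ i → fromℤ (ℤ.- i) ≡ ℚ.- fromℤ i
  fromℤ-homo‿- i = toℚᵘ-injective (begin
    toℚᵘ (fromℤ (ℤ.- i))  ≈⟨ toℚᵘ-/ (ℤ.- i) 0 ⟩
    mkℚᵘ (ℤ.- i) 0        ≈⟨ ℚᵘP.-‿cong (toℚᵘ-/ i 0) ⟨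
    ℚᵘ.- toℚᵘ (fromℤ i)   ≈⟨ toℚᵘ-homo‿- (fromℤ i) ⟨
    toℚᵘ (ℚ.- fromℤ i)    ∎)

  i/2≡fromℤ[i]*½ : ∀ i → i ℚ./ 2 ≡ fromℤ i ℚ.* ½
  i/2≡fromℤ[i]*½ i = toℚᵘ-injective (begin
    toℚᵘ (i ℚ./ 2)              ≈⟨ toℚᵘ-/ i 1 ⟩
    mkℚᵘ i 1                    ≈⟨ *≡* (solve 1 (λ i → i :* con (+ 2)
                                      := (i :* con (+ 1)) :* con (+ 2)) refl i) ⟩
    mkℚᵘ i 0 ℚᵘ.* toℚᵘ ½        ≈⟨ ℚᵘP.*-cong (toℚᵘ-/ i 0) ℚᵘP.≃-refl ⟨
    toℚᵘ (fromℤ i) ℚᵘ.* toℚᵘ ½  ≈⟨ toℚᵘ-homo-* (fromℤ i) ½ ⟨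
    toℚᵘ (fromℤ i ℚ.* ½)        ∎)

fromℤ-homo-sub : ∀ i j → fromℤ (i ℤ.- j) ≡ fromℤ i ℚ.- fromℤ j
fromℤ-homo-sub i j = trans (fromℤ-homo-+ i (ℤ.- j)) (cong (fromℤ i ℚ.+_) (fromℤ-homo‿- j))

record FirstColumnEquations (D x y a b c d μ₁ μ₂ m₁ m₂ : ℚ) : Set where
  open Data.Rational using (_+_; _*_)
  field
    re₁₁ : μ₁ * x + D * y ≡ a * μ₂ + b * m₂
    im₁₁ : x + μ₁ * y ≡ a
    re₂₁ : m₁ * x ≡ c * μ₂ + d * m₂
    im₂₁ : m₁ * y ≡ c

Amatℚ : ℤ → ℚ → ℚ → M2 QD
Amatℚ D m μ = mat (embQ D 1ℚ) (embQ D ((μ ℚ.- 1ℚ) ℚ.* ½)) (embQ D 0ℚ) (embQ D (m ℚ.* ½))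

Amat≡Amatℚ : ∀ D m μ → Amat D m μ ≡ Amatℚ D (fromℤ (+ m)) (fromℤ μ)
Amat≡Amatℚ D m μ =
  cong₂ (λ h k → mat (embQ D 1ℚ) (embQ D h) (embQ D 0ℚ) (embQ D k))
        (trans (i/2≡fromℤ[i]*½ (μ ℤ.- + 1)) (cong (ℚ._* ½) (fromℤ-homo-sub μ (+ 1))))
        (i/2≡fromℤ[i]*½ (+ m))

module _ where
  open ℚSolver.+-*-Solver

  -- Both sides are rebuilt from polynomials in eleven variables by copies of
  -- mulQD, mulM, W and Amat; their evaluation is definitionally the original
  -- matrices, so each entry of the equation can be normalised by the ring solver.
  private
    Poly : Set
    Poly = Polynomial 11

    record QDᵖ : Set where
      constructor _+√ᵖ_
      field reᵖ imᵖ : Poly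
    open QDᵖ

    xᵖ yᵖ aᵖ bᵖ cᵖ dᵖ μ₁ᵖ μ₂ᵖ m₁ᵖ m₂ᵖ Dᵖ : Poly
    xᵖ = var (# 0); yᵖ = var (# 1); aᵖ = var (# 2); bᵖ = var (# 3)
    cᵖ = var (# 4); dᵖ = var (# 5); μ₁ᵖ = var (# 6); μ₂ᵖ = var (# 7)
    m₁ᵖ = var (# 8); m₂ᵖ = var (# 9); Dᵖ = var (# 10)

    embᵖ : Poly → QDᵖ
    embᵖ p = p +√ᵖ con 0ℚ

    addᵖ mulᵖ : QDᵖ → QDᵖ → QDᵖ
    addᵖ (p +√ᵖ q) (r +√ᵖ s) = (p :+ r) +√ᵖ (q :+ s)
    mulᵖ (p +√ᵖ q) (r +√ᵖ s) = (p :* r :+ q :* s :* Dᵖ) +√ᵖ (p :* s :+ q :* r)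

    mulMᵖ : M2 QDᵖ → M2 QDᵖ → M2 QDᵖ
    mulMᵖ (mat p q r s) (mat p' q' r' s') =
      mat (addᵖ (mulᵖ p p') (mulᵖ q r')) (addᵖ (mulᵖ p q') (mulᵖ q s'))
          (addᵖ (mulᵖ r p') (mulᵖ s r')) (addᵖ (mulᵖ r q') (mulᵖ s s'))

    Wᵖ : M2 QDᵖ
    Wᵖ = mat (con ½ +√ᵖ con ½) (con ½ +√ᵖ con (ℤ.- (+ 1) ℚ./ 2)) (embᵖ (con 1ℚ)) (embᵖ (con 1ℚ))

    Amatᵖ : Poly → Poly → M2 QDᵖ
    Amatᵖ m μ = mat (embᵖ (con 1ℚ)) (embᵖ ((μ :- con 1ℚ) :* con ½)) (embᵖ (con 0ℚ)) (embᵖ (m :* con ½))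

    lhsᵖ rhsᵖ : M2 QDᵖ
    lhsᵖ = mulMᵖ (mulMᵖ (Amatᵖ m₁ᵖ μ₁ᵖ) Wᵖ) (mat (xᵖ +√ᵖ yᵖ) (embᵖ (con 0ℚ)) (embᵖ (con 0ℚ)) (xᵖ +√ᵖ (:- yᵖ)))
    rhsᵖ = mulMᵖ (mulMᵖ (mat (embᵖ aᵖ) (embᵖ bᵖ) (embᵖ cᵖ) (embᵖ dᵖ)) (Amatᵖ m₂ᵖ μ₂ᵖ)) Wᵖ

    twoᵖ : Poly
    twoᵖ = con (+ 2 ℚ./ 1)

    doubles-equal : ∀ {u v l r} → u ≡ v → (+ 2 ℚ./ 1) ℚ.* u ≡ l → (+ 2 ℚ./ 1) ℚ.* v ≡ r → l ≡ r
    doubles-equal refl 2u≡l 2v≡r = trans (sym 2u≡l) 2v≡r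

  first-column-entries : ∀ D x y a b c d μ₁ μ₂ m₁ m₂ →
    mulM D (mulM D (Amatℚ D m₁ μ₁) (W D)) (diagM D (x +√ y))
      ≡ mulM D (mulM D (mat (embQ D a) (embQ D b) (embQ D c) (embQ D d)) (Amatℚ D m₂ μ₂)) (W D) →
    FirstColumnEquations (fromℤ D) x y a b c d μ₁ μ₂ m₁ m₂
  first-column-entries D x y a b c d μ₁ μ₂ m₁ m₂ eq = record
    { re₁₁ = doubles-equal (cong (re ∘ m11) eq)
        (prove ρ (twoᵖ :* reᵖ (m11 lhsᵖ)) (μ₁ᵖ :* xᵖ :+ Dᵖ :* yᵖ) refl)
        (prove ρ (twoᵖ :* reᵖ (m11 rhsᵖ)) (aᵖ :* μ₂ᵖ :+ bᵖ :* m₂ᵖ) refl)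
    ; im₁₁ = doubles-equal (cong (im ∘ m11) eq)
        (prove ρ (twoᵖ :* imᵖ (m11 lhsᵖ)) (xᵖ :+ μ₁ᵖ :* yᵖ) refl)
        (prove ρ (twoᵖ :* imᵖ (m11 rhsᵖ)) aᵖ refl)
    ; re₂₁ = doubles-equal (cong (re ∘ m21) eq)
        (prove ρ (twoᵖ :* reᵖ (m21 lhsᵖ)) (m₁ᵖ :* xᵖ) refl)
        (prove ρ (twoᵖ :* reᵖ (m21 rhsᵖ)) (cᵖ :* μ₂ᵖ :+ dᵖ :* m₂ᵖ) refl)
    ; im₂₁ = doubles-equal (cong (im ∘ m21) eq)
        (prove ρ (twoᵖ :* imᵖ (m21 lhsᵖ)) (m₁ᵖ :* yᵖ) refl)
        (prove ρ (twoᵖ :* imᵖ (m21 rhsᵖ)) cᵖ refl)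
    }
    where
    ρ : Vec ℚ 11
    ρ = x ∷ y ∷ a ∷ b ∷ c ∷ d ∷ μ₁ ∷ μ₂ ∷ m₁ ∷ m₂ ∷ fromℤ D ∷ []

module _ {D x y a b c d μ₁ μ₂ m₁ m₂ : ℚ} (eqs : FirstColumnEquations D x y a b c d μ₁ μ₂ m₁ m₂) where
  open FirstColumnEquations eqs
  open Data.Rational using (_+_; _*_; _-_)
  open ≡-Reasoning
  open ℚSolver.+-*-Solver

  m₁a≡c[μ₁+μ₂]+dm₂ : m₁ * a ≡ c * (μ₁ + μ₂) + d * m₂
  m₁a≡c[μ₁+μ₂]+dm₂ = begin
    m₁ * a                      ≡⟨ cong (m₁ *_) im₁₁ ⟨
    m₁ * (x + μ₁ * y)           ≡⟨ solve 4 (λ m₁ x μ₁ y → m₁ :* (x :+ μ₁ :* y)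
                                     := m₁ :* x :+ μ₁ :* (m₁ :* y)) refl m₁ x μ₁ y ⟩
    m₁ * x + μ₁ * (m₁ * y)      ≡⟨ cong₂ (λ u v → u + μ₁ * v) re₂₁ im₂₁ ⟩
    c * μ₂ + d * m₂ + μ₁ * c    ≡⟨ solve 5 (λ c μ₁ μ₂ d m₂ → c :* μ₂ :+ d :* m₂ :+ μ₁ :* c
                                     := c :* (μ₁ :+ μ₂) :+ d :* m₂) refl c μ₁ μ₂ d m₂ ⟩
    c * (μ₁ + μ₂) + d * m₂      ∎

  c[D-μ₂²]≡m₂[d[μ₂-μ₁]+m₁b] : c * (D - μ₂ * μ₂) ≡ m₂ * (d * (μ₂ - μ₁) + m₁ * b)
  c[D-μ₂²]≡m₂[d[μ₂-μ₁]+m₁b] = begin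
    c * (D - μ₂ * μ₂)
      ≡⟨ solve 6 (λ c D μ₁ μ₂ d m₂ → c :* (D :- μ₂ :* μ₂)
           := μ₁ :* (c :* μ₂ :+ d :* m₂) :+ D :* c :- μ₂ :* (c :* (μ₁ :+ μ₂) :+ d :* m₂) :+ d :* m₂ :* (μ₂ :- μ₁))
           refl c D μ₁ μ₂ d m₂ ⟩
    μ₁ * (c * μ₂ + d * m₂) + D * c - μ₂ * (c * (μ₁ + μ₂) + d * m₂) + r
      ≡⟨ cong₂ (λ u v → μ₁ * u + D * v - μ₂ * (c * (μ₁ + μ₂) + d * m₂) + r) re₂₁ im₂₁ ⟨
    μ₁ * (m₁ * x) + D * (m₁ * y) - μ₂ * (c * (μ₁ + μ₂) + d * m₂) + r
      ≡⟨ cong (λ u → μ₁ * (m₁ * x) + D * (m₁ * y) - μ₂ * u + r) m₁a≡c[μ₁+μ₂]+dm₂ ⟨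
    μ₁ * (m₁ * x) + D * (m₁ * y) - μ₂ * (m₁ * a) + r
      ≡⟨ solve 8 (λ μ₁ m₁ x D y μ₂ a r → μ₁ :* (m₁ :* x) :+ D :* (m₁ :* y) :- μ₂ :* (m₁ :* a) :+ r
           := m₁ :* (μ₁ :* x :+ D :* y) :- μ₂ :* (m₁ :* a) :+ r) refl μ₁ m₁ x D y μ₂ a r ⟩
    m₁ * (μ₁ * x + D * y) - μ₂ * (m₁ * a) + r
      ≡⟨ cong (λ u → m₁ * u - μ₂ * (m₁ * a) + r) re₁₁ ⟩
    m₁ * (a * μ₂ + b * m₂) - μ₂ * (m₁ * a) + r
      ≡⟨ solve 7 (λ m₁ a μ₂ b m₂ d μ₁ → m₁ :* (a :* μ₂ :+ b :* m₂) :- μ₂ :* (m₁ :* a) :+ d :* m₂ :* (μ₂ :- μ₁)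
           := m₂ :* (d :* (μ₂ :- μ₁) :+ m₁ :* b)) refl m₁ a μ₂ b m₂ d μ₁ ⟩
    m₂ * (d * (μ₂ - μ₁) + m₁ * b) ∎
    where
    r : ℚ
    r = d * m₂ * (μ₂ - μ₁)

column-identities : ∀ D m₁ m₂ μ₁ μ₂ a b c d ζ →
  mulM D (mulM D (Amat D m₁ μ₁) (W D)) (diagM D ζ)
    ≡ mulM D (mulM D (embM D (mat a b c d)) (Amat D m₂ μ₂)) (W D) →
    (+ m₁ ℤ.* a ≡ c ℤ.* (μ₁ ℤ.+ μ₂) ℤ.+ d ℤ.* + m₂)
  × (c ℤ.* (D ℤ.- μ₂ ℤ.* μ₂) ≡ + m₂ ℤ.* (d ℤ.* (μ₂ ℤ.- μ₁) ℤ.+ + m₁ ℤ.* b))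
column-identities D m₁ m₂ μ₁ μ₂ a b c d (x +√ y) eq =
    fromℤ-injective (begin
      fromℤ (+ m₁ ℤ.* a)                   ≡⟨ fromℤ-homo-* (+ m₁) a ⟩
      fromℤ (+ m₁) * fromℤ a               ≡⟨ m₁a≡c[μ₁+μ₂]+dm₂ entries ⟩
      fromℤ c * (fromℤ μ₁ + fromℤ μ₂) + fromℤ d * fromℤ (+ m₂)
        ≡⟨ cong₂ _+_ (trans (fromℤ-homo-* c _) (cong (fromℤ c *_) (fromℤ-homo-+ μ₁ μ₂)))
                     (fromℤ-homo-* d (+ m₂)) ⟨
      fromℤ (c ℤ.* (μ₁ ℤ.+ μ₂)) + fromℤ (d ℤ.* + m₂)
        ≡⟨ fromℤ-homo-+ (c ℤ.* (μ₁ ℤ.+ μ₂)) (d ℤ.* + m₂) ⟨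
      fromℤ (c ℤ.* (μ₁ ℤ.+ μ₂) ℤ.+ d ℤ.* + m₂) ∎)
  , fromℤ-injective (begin
      fromℤ (c ℤ.* (D ℤ.- μ₂ ℤ.* μ₂))
        ≡⟨ trans (fromℤ-homo-* c _) (cong (fromℤ c *_)
             (trans (fromℤ-homo-sub D _) (cong (fromℤ D -_) (fromℤ-homo-* μ₂ μ₂)))) ⟩
      fromℤ c * (fromℤ D - fromℤ μ₂ * fromℤ μ₂)
        ≡⟨ c[D-μ₂²]≡m₂[d[μ₂-μ₁]+m₁b] entries ⟩
      fromℤ (+ m₂) * (fromℤ d * (fromℤ μ₂ - fromℤ μ₁) + fromℤ (+ m₁) * fromℤ b)
        ≡⟨ trans (fromℤ-homo-* (+ m₂) _) (cong (fromℤ (+ m₂) *_)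
             (trans (fromℤ-homo-+ (d ℤ.* (μ₂ ℤ.- μ₁)) _)
               (cong₂ _+_ (trans (fromℤ-homo-* d _) (cong (fromℤ d *_) (fromℤ-homo-sub μ₂ μ₁)))
                          (fromℤ-homo-* (+ m₁) b)))) ⟨
      fromℤ (+ m₂ ℤ.* (d ℤ.* (μ₂ ℤ.- μ₁) ℤ.+ + m₁ ℤ.* b)) ∎)
  where
  open Data.Rational using (_+_; _*_; _-_)
  open ≡-Reasoning
  eq′ = subst₂ (λ A₁ A₂ → mulM D (mulM D A₁ (W D)) (diagM D (x +√ y))
                            ≡ mulM D (mulM D (embM D (mat a b c d)) A₂) (W D))
               (Amat≡Amatℚ D m₁ μ₁) (Amat≡Amatℚ D m₂ μ₂) eq
  entries = first-column-entries D x y (fromℤ a) (fromℤ b) (fromℤ c) (fromℤ d)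
              (fromℤ μ₁) (fromℤ μ₂) (fromℤ (+ m₁)) (fromℤ (+ m₂)) eq′

∣*∧∣*⇒∣ : ∀ {n x v q} → Coprime n (gcd v q) → n ∣ x ℕ.* v → n ∣ x ℕ.* q → n ∣ x
∣*∧∣*⇒∣ {n} {x} {v} {q} n⊥gcd n∣xv n∣xq = coprime-divisor n⊥gcd n∣gcd*x
  where
  n∣gcd*x : n ∣ gcd v q ℕ.* x
  n∣gcd*x = subst (n ∣_) (trans (sym (c*gcd[m,n]≡gcd[cm,cn] x v q)) (ℕP.*-comm x (gcd v q)))
                  (gcd-greatest n∣xv n∣xq)

odd∣2*⇒∣ : ∀ {n x} → n % 2 ≡ 1 → n ∣ 2 ℕ.* x → n ∣ x
odd∣2*⇒∣ {n} odd = coprime-divisor n⊥2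
  where
  n⊥2 : Coprime n 2
  n⊥2 (d∣n , d∣2) with prime⇒irreducible prime[2] d∣2
  ... | inj₁ d≡1 = d≡1
  ... | inj₂ refl with () ← trans (sym odd) (n∣m⇒m%n≡0 n 2 d∣n)

even∣2*⇒/2∣ : ∀ {n x} → n % 2 ≡ 0 → n ∣ 2 ℕ.* x → n / 2 ∣ x
even∣2*⇒/2∣ {n} even n∣2x =
  *-cancelˡ-∣ 2 (subst (_∣ _) (sym (m*[n/m]≡n (m%n≡0⇒n∣m n 2 even))) n∣2x)

squarefree∧square∣⇒≡1 : ∀ {D s} → SquareFree D → s ℕ.* s ∣ ℤ.∣ D ∣ → s ≡ 1
squarefree∧square∣⇒≡1 {s = zero} sf 0∣D =
  ⊥-elim (sf 2 prime[2] (subst (4 ∣_) (sym (0∣⇒≡0 0∣D)) (4 ∣0)))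
squarefree∧square∣⇒≡1 {s = s@(suc _)} sf s²∣D with factorise s
... | record { factors = [] ; isFactorisation = s≡1 } = s≡1
... | record { factors = p ∷ ps ; isFactorisation = s≡p*ps ; factorsPrime = p-prime ∷ _ } =
  ⊥-elim (sf p p-prime (∣-trans (*-pres-∣ p∣s p∣s) s²∣D))
  where
  p∣s : p ∣ s
  p∣s = divides (product ps) (trans s≡p*ps (ℕP.*-comm p (product ps)))

squarefree⇒coprime[n,gcd[ν,q]] : ∀ D μ ν {q : ℤ} {m n : ℕ} → SquareFree D →
  D ℤ.- μ ℤ.* μ ≡ + m ℤ.* q → n ∣ m → (+ n) ℤD.∣ (μ ℤ.- ν) → Coprime n (gcd ℤ.∣ ν ∣ ℤ.∣ q ∣)
squarefree⇒coprime[n,gcd[ν,q]] D μ ν {q} {m} {n} sf D-μ²≡mq n∣m n∣μ-ν {s} (s∣n , s∣gcd) =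
  squarefree∧square∣⇒≡1 {D} sf (subst (_∣ ℤ.∣ D ∣) (ℤP.abs-* (+ s) (+ s)) (ℤS.∣⇒∣ᵤ s²∣D))
  where
  open ℤSolver.+-*-Solver
  *-pres-∣ˢ : ∀ {i j k l} → i ℤS.∣ j → k ℤS.∣ l → i ℤ.* k ℤS.∣ j ℤ.* l
  *-pres-∣ˢ {i} {j} {k} {l} i∣j k∣l = ℤS.∣-trans (ℤS.*-monoʳ-∣ i k∣l) (ℤS.*-monoˡ-∣ l i∣j)
  s∣ν : + s ℤS.∣ ν
  s∣ν = ℤS.∣ᵤ⇒∣ (∣-trans s∣gcd (gcd[m,n]∣m ℤ.∣ ν ∣ ℤ.∣ q ∣))
  s∣q : + s ℤS.∣ q
  s∣q = ℤS.∣ᵤ⇒∣ (∣-trans s∣gcd (gcd[m,n]∣n ℤ.∣ ν ∣ ℤ.∣ q ∣))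
  s∣+n : + s ℤS.∣ + n
  s∣+n = ℤS.∣ᵤ⇒∣ s∣n
  +n∣μ-ν : + n ℤS.∣ μ ℤ.- ν
  +n∣μ-ν = ℤS.∣ᵤ⇒∣ n∣μ-ν
  s∣μ : + s ℤS.∣ μ
  s∣μ = ℤS.∣m+n∣n⇒∣m (ℤS.∣-trans s∣+n +n∣μ-ν) (ℤS.∣m⇒∣-m s∣ν)
  s∣m : + s ℤS.∣ + m
  s∣m = ℤS.∣ᵤ⇒∣ (∣-trans s∣n n∣m)
  μ²+mq≡D : μ ℤ.* μ ℤ.+ + m ℤ.* q ≡ D
  μ²+mq≡D = trans (cong (ℤ._+_ (μ ℤ.* μ)) (sym D-μ²≡mq))
                  (solve 2 (λ μ D → μ :* μ :+ (D :- μ :* μ) := D) refl μ D)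
  s²∣D : + s ℤ.* + s ℤS.∣ D
  s²∣D = subst (_ ℤS.∣_) μ²+mq≡D (ℤS.∣m∣n⇒∣m+n (*-pres-∣ˢ s∣μ s∣μ) (*-pres-∣ˢ s∣m s∣q))

n∣2∣c∣ : ∀ D n m₁ m₂ μ₁ μ₂ ν q a b c d → SquareFree D → 0 ℕ.< m₂ →
  D ℤ.- μ₂ ℤ.* μ₂ ≡ + m₂ ℤ.* q → n ∣ m₁ → n ∣ m₂ →
  (+ n) ℤD.∣ (μ₁ ℤ.- ν) → (+ n) ℤD.∣ (μ₂ ℤ.- ν) →
    (+ m₁ ℤ.* a ≡ c ℤ.* (μ₁ ℤ.+ μ₂) ℤ.+ d ℤ.* + m₂)
  × (c ℤ.* (D ℤ.- μ₂ ℤ.* μ₂) ≡ + m₂ ℤ.* (d ℤ.* (μ₂ ℤ.- μ₁) ℤ.+ + m₁ ℤ.* b)) →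
  n ∣ 2 ℕ.* ℤ.∣ c ∣
n∣2∣c∣ D n m₁ m₂ μ₁ μ₂ ν q a b c d sf 0<m₂ D-μ₂²≡m₂q n∣m₁ n∣m₂ n∣μ₁-ν n∣μ₂-ν (m₁a≡ , c[D-μ₂²]≡) =
  subst (n ∣_) (ℤP.abs-* (+ 2) c)
    (∣*∧∣*⇒∣ (squarefree⇒coprime[n,gcd[ν,q]] D μ₂ ν sf D-μ₂²≡m₂q n∣m₂ n∣μ₂-ν)
             (∣*⇒∣∣*∣ (+ 2 * c) ν n∣2cν) (∣*⇒∣∣*∣ (+ 2 * c) q n∣2cq))
  where
  open ℤSolver.+-*-Solver
  open Data.Integer using (_+_; _*_; _-_)
  instance
    m₂≢0 : ℤ.NonZero (+ m₂)
    m₂≢0 = ℕ.>-nonZero 0<m₂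
  N : ℤ
  N = + n
  ∣*⇒∣∣*∣ : ∀ i j → N ℤS.∣ i * j → n ∣ ℤ.∣ i ∣ ℕ.* ℤ.∣ j ∣
  ∣*⇒∣∣*∣ i j N∣ij = subst (n ∣_) (ℤP.abs-* i j) (ℤS.∣⇒∣ᵤ N∣ij)
  N∣m₁ : N ℤS.∣ + m₁
  N∣m₁ = ℤS.∣ᵤ⇒∣ n∣m₁
  N∣m₂ : N ℤS.∣ + m₂
  N∣m₂ = ℤS.∣ᵤ⇒∣ n∣m₂
  N∣μ₁-ν : N ℤS.∣ μ₁ - ν
  N∣μ₁-ν = ℤS.∣ᵤ⇒∣ n∣μ₁-ν
  N∣μ₂-ν : N ℤS.∣ μ₂ - ν
  N∣μ₂-ν = ℤS.∣ᵤ⇒∣ n∣μ₂-ν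

  n∣c[μ₁+μ₂] : N ℤS.∣ c * (μ₁ + μ₂)
  n∣c[μ₁+μ₂] = ℤS.∣m+n∣n⇒∣m (subst (N ℤS.∣_) m₁a≡ (ℤS.∣m⇒∣m*n a N∣m₁)) (ℤS.∣n⇒∣m*n d N∣m₂)

  n∣2cν : N ℤS.∣ (+ 2 * c) * ν
  n∣2cν = subst (N ℤS.∣_)
    (solve 4 (λ c μ₁ μ₂ ν → c :* (μ₁ :+ μ₂) :- c :* (μ₁ :- ν) :- c :* (μ₂ :- ν)
                := (con (+ 2) :* c) :* ν) refl c μ₁ μ₂ ν)
    (ℤS.∣m∣n⇒∣m-n (ℤS.∣m∣n⇒∣m-n n∣c[μ₁+μ₂] (ℤS.∣n⇒∣m*n c N∣μ₁-ν)) (ℤS.∣n⇒∣m*n c N∣μ₂-ν))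

  cq≡d[μ₂-μ₁]+m₁b : c * q ≡ d * (μ₂ - μ₁) + + m₁ * b
  cq≡d[μ₂-μ₁]+m₁b = ℤP.*-cancelˡ-≡ (+ m₂) _ _
    (trans (solve 3 (λ m c q → m :* (c :* q) := c :* (m :* q)) refl (+ m₂) c q)
           (trans (cong (c *_) (sym D-μ₂²≡m₂q)) c[D-μ₂²]≡))

  n∣μ₂-μ₁ : N ℤS.∣ μ₂ - μ₁
  n∣μ₂-μ₁ = subst (N ℤS.∣_) (solve 3 (λ μ₁ μ₂ ν → (μ₂ :- ν) :- (μ₁ :- ν) := μ₂ :- μ₁) refl μ₁ μ₂ ν)
              (ℤS.∣m∣n⇒∣m-n N∣μ₂-ν N∣μ₁-ν)

  n∣2cq : N ℤS.∣ (+ 2 * c) * q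
  n∣2cq = subst (N ℤS.∣_) (sym (ℤP.*-assoc (+ 2) c q)) (ℤS.∣n⇒∣m*n (+ 2)
    (subst (N ℤS.∣_) (sym cq≡d[μ₂-μ₁]+m₁b) (ℤS.∣m∣n⇒∣m+n (ℤS.∣n⇒∣m*n d n∣μ₂-μ₁) (ℤS.∣m⇒∣m*n b N∣m₁))))

lemma3p5 : (D : ℤ) → + 1 ℤ.< D → SquareFree D → (+ 4) ℤD.∣ (D ℤ.- + 1)
    → (m₁ m₂ : ℕ) (μ₁ μ₂ : ℤ)
    → 0 ℕ.< m₁ → 0 ℕ.< m₂ → 2 ∣ m₁ → 2 ∣ m₂
    → (+ m₁) ℤD.∣ (μ₁ ℤ.* μ₁ ℤ.- D) → (+ m₂) ℤD.∣ (μ₂ ℤ.* μ₂ ℤ.- D)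
    → ∃[ q₁ ] (D ℤ.- μ₁ ℤ.* μ₁ ≡ + m₁ ℤ.* q₁ × (+ 2) ℤD.∣ q₁)
    → ∃[ q₂ ] (D ℤ.- μ₂ ℤ.* μ₂ ≡ + m₂ ℤ.* q₂ × (+ 2) ℤD.∣ q₂)
    → (n : ℕ) (ν : ℤ) → 1 ℕ.≤ n → (+ n) ℤD.∣ (ν ℤ.* ν ℤ.- D)
    → n ∣ m₁ → n ∣ m₂ → (+ n) ℤD.∣ (μ₁ ℤ.- ν) → (+ n) ℤD.∣ (μ₂ ℤ.- ν)
    → (γ : M2 ℤ) → InSL2Z γ
    → (ζ : QD) → TotallyPositive D ζ
    → mulM D (mulM D (Amat D m₁ μ₁) (W D)) (diagM D ζ)
        ≡ mulM D (mulM D (embM D γ) (Amat D m₂ μ₂)) (W D)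
    → (n % 2 ≡ 1 → InΓ₀ n γ) × (n % 2 ≡ 0 → InΓ₀ (n / 2) γ)
lemma3p5 D _ sf _ m₁ m₂ μ₁ μ₂ _ 0<m₂ _ _ _ _ _ (q₂ , D-μ₂²≡m₂q₂ , _) n ν _ _
         n∣m₁ n∣m₂ n∣μ₁-ν n∣μ₂-ν (mat a b c d) det≡1 ζ _ eq
  = (λ odd → det≡1 , odd∣2*⇒∣ odd n∣2c) , (λ even → det≡1 , even∣2*⇒/2∣ even n∣2c)
  where
  n∣2c : n ∣ 2 ℕ.* ℤ.∣ c ∣
  n∣2c = n∣2∣c∣ D n m₁ m₂ μ₁ μ₂ ν q₂ a b c d sf 0<m₂ D-μ₂²≡m₂q₂
                n∣m₁ n∣m₂ n∣μ₁-ν n∣μ₂-ν (column-identities D m₁ m₂ μ₁ μ₂ a b c d ζ eq)
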